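{- Let $q=2^r$, $n=2^s$ with $s\in\mathbb{Z}_{>0}$, and $N_1=(q-1)^{n-1}$. For every $a\in\mathbb{F}_q^*$, the Hamming weight of $c(a)$ is \[ w(c(a))=\frac{N_1}{2}-\frac12K_{n-1}(\lambda;a). \]
   Context: $tr:\mathbb{F}_q\to\mathbb{F}_2$ is the absolute trace, $\lambda(x)=(-1)^{tr(x)}$, and $K_{n-1}(\lambda;a)=\sum_{\alpha_1,\dots,\alpha_{n-1}\in\mathbb{F}_q^*}\lambda(\alpha_1+\cdots+\alpha_{n-1}+a\alpha_1^{ -1}\cdots\alpha_{n-1}^{ -1})$. Fixing an ordering of $(\mathbb{F}_q^*)^{n-1}$, $c(a)\in\mathbb{F}_2^{N_1}$ is the vector whose entry at the tuple $(\alpha_1,\dots,\alpha_{n-1})$ is $tr(a(\alpha_1+\cdots+\alpha_{n-1}+\alpha_1^{ -1}\cdots\alpha_{n-1}^{ -1}))$. -}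

module Defs where

open import Level using (0ℓ)
open import Data.Nat as ℕ using (ℕ; zero; suc)
open import Data.Integer as ℤ using (ℤ)
open import Data.Fin using (Fin)
open import Data.Bool using (Bool; true; false; if_then_else_)
open import Data.List using (List; []; _∷_; map; filter; concatMap; allFin; length)
open import Data.Vec as Vec using (Vec; []; _∷_)
open import Function.Bundles using (_↔_; Inverse)
open import Relation.Nullary using (¬_; does)
open import Relation.Nullary.Decidable using (¬?)
open import Relation.Binary.PropositionalEquality using (_≡_; _≢_)
open import Relation.Binary.Definitions using (DecidableEquality)
open import Algebra.Structures using (IsCommutativeRing)

-- A finite field with exactly q elements (equality is propositional).
-- Multiplicative inverse is a total function, only constrained on nonzero elements.
record FiniteField (q : ℕ) : Set₁ where
  infixl 6 _+_
  infixl 7 _*_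
  field
    Carrier : Set
    _+_ _*_ : Carrier → Carrier → Carrier
    -_      : Carrier → Carrier
    0# 1#   : Carrier
    isCommutativeRing : IsCommutativeRing _≡_ _+_ _*_ -_ 0# 1#
    _⁻¹     : Carrier → Carrier
    ⁻¹-inverse : ∀ x → x ≢ 0# → x * (x ⁻¹) ≡ 1#
    0≢1     : 0# ≢ 1#
    _≟_     : DecidableEquality Carrier
    enum    : Fin q ↔ Carrier

module _ {q : ℕ} (F : FiniteField q) where
  open FiniteField F

  trace : ℕ → Carrier → Carrier
  trace zero    y = 0#
  trace (suc k) y = y + trace k (y * y)

  -- the element tr(x) of F_2 ⊆ F_q, encoded as a Bool (true ↔ tr(x) = 1, i.e. tr(x) ≠ 0)
  trBit : ℕ → Carrier → Bool
  trBit r x = does (¬? (trace r x ≟ 0#))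

  lam : ℕ → Carrier → ℤ
  lam r x = if trBit r x then ℤ.- ℤ.1ℤ else ℤ.1ℤ

  nonzeros : List Carrier
  nonzeros = filter (λ x → ¬? (x ≟ 0#)) (map (Inverse.to enum) (allFin q))

tuples : {A : Set} → (k : ℕ) → List A → List (Vec A k)
tuples zero    xs = [] ∷ []
tuples (suc k) xs = concatMap (λ x → map (x ∷_) (tuples k xs)) xs

sumℤ : List ℤ → ℤ
sumℤ []       = ℤ.0ℤ
sumℤ (x ∷ xs) = x ℤ.+ sumℤ xs

module _ {q : ℕ} (F : FiniteField q) where
  open FiniteField F

  sumF : {k : ℕ} → Vec Carrier k → Carrier
  sumF = Vec.foldr _ _+_ 0#

  prodInv : {k : ℕ} → Vec Carrier k → Carrier
  prodInv = Vec.foldr _ (λ α acc → (α ⁻¹) * acc) 1#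

  Kloosterman : (r k : ℕ) → Carrier → ℤ
  Kloosterman r k a =
    sumℤ (map (λ α → lam F r (sumF α + a * prodInv α)) (tuples k (nonzeros F)))

  -- the codeword c(a) ∈ F_2^{N₁}, coordinates indexed by (F_q^*)^k in the order of 'tuples'
  codeword : (r k : ℕ) → Carrier → List Bool
  codeword r k a = map (λ α → trBit F r (a * (sumF α + prodInv α))) (tuples k (nonzeros F))

weight : List Bool → ℕ
weight []           = 0
weight (true ∷ bs)  = suc (weight bs)
weight (false ∷ bs) = weight bs

{-# OPTIONS --safe #-}
-- With k = n − 1, reading each coordinate of c(a) as a sign gives
-- N₁ = 2 w(c(a)) + Σ_α λ(a(α₁ + ⋯ + α_k + α₁⁻¹ ⋯ α_k⁻¹)).  The substitution α ↦ aα turns this sign sum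
-- into K_k(λ; aⁿ), because aⁿ a⁻ᵏ = a.  As x^q = x, squaring is a permutation of F_q fixing 0 which
-- preserves the trace, and in characteristic two it is additive, so the substitution α ↦ α² gives
-- K_k(λ; b²) = K_k(λ; b); since n = 2^s, K_k(λ; aⁿ) = K_k(λ; a).  Fermat's x^(q−1) = 1 for x ≠ 0 comes
-- from comparing the product of all units with its image under multiplication by x.
module Submission where

open import Defs
open import Level using (0ℓ)
open import Algebra.Bundles using (CommutativeMonoid; CommutativeRing)
open import Algebra.Structures using (IsCommutativeRing)
open import Data.Bool using (Bool; true; false; if_then_else_)
open import Data.Empty using (⊥-elim)
open import Data.Fin as Fin using (Fin)
import Data.Fin.Properties as Fin
open import Data.Integer as ℤ using (ℤ; +_)
import Data.Integer.Properties as ℤ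
open import Data.Integer.Solver using (module +-*-Solver)
open import Data.List using (List; []; _∷_; _++_; map; filter; concatMap; length; tabulate; allFin)
import Data.List.Properties as List
open import Data.List.Relation.Unary.All using (All; []; _∷_)
import Data.List.Relation.Unary.All.Properties as All
open import Data.Nat as ℕ using (ℕ; zero; suc; _∸_; _<_)
import Data.Nat.Properties as ℕ
open import Data.Vec as Vec using (Vec; []; _∷_)
import Data.Vec.Relation.Unary.All as VecAll
open import Function.Base using (id; _∘_; const)
open import Function.Bundles using (_↔_; Inverse; mk↔ₛ′)
open import Function.Construct.Composition using (_↔-∘_)
open import Function.Construct.Symmetry using (↔-sym)
open import Relation.Nullary using (¬_; Dec; does; yes; no)
open import Relation.Nullary.Decidable using (¬?)
open import Relation.Unary using (Pred; Decidable)
open import Relation.Binary.PropositionalEquality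
  using (_≡_; _≢_; refl; sym; trans; cong; cong₂; module ≡-Reasoning)
open ≡-Reasoning

private variable
  A B : Set

sign : Bool → ℤ
sign b = if b then ℤ.- ℤ.1ℤ else ℤ.1ℤ

weight+sum-sign : ∀ bs → + 2 ℤ.* + weight bs ℤ.+ sumℤ (map sign bs) ≡ + length bs
weight+sum-sign []          = refl
weight+sum-sign (true ∷ bs) = begin
  + 2 ℤ.* (ℤ.1ℤ ℤ.+ w) ℤ.+ (ℤ.- ℤ.1ℤ ℤ.+ S)
    ≡⟨ solve 2 (λ w S → con (+ 2) :* (con ℤ.1ℤ :+ w) :+ (con (ℤ.- ℤ.1ℤ) :+ S)
                        := con ℤ.1ℤ :+ (con (+ 2) :* w :+ S)) refl w S ⟩
  ℤ.1ℤ ℤ.+ (+ 2 ℤ.* w ℤ.+ S)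
    ≡⟨ cong (ℤ._+_ ℤ.1ℤ) (weight+sum-sign bs) ⟩
  ℤ.1ℤ ℤ.+ + length bs
    ∎
  where open +-*-Solver
        w = + weight bs; S = sumℤ (map sign bs)
weight+sum-sign (false ∷ bs) = begin
  + 2 ℤ.* w ℤ.+ (ℤ.1ℤ ℤ.+ S)
    ≡⟨ solve 2 (λ w S → con (+ 2) :* w :+ (con ℤ.1ℤ :+ S) := con ℤ.1ℤ :+ (con (+ 2) :* w :+ S)) refl w S ⟩
  ℤ.1ℤ ℤ.+ (+ 2 ℤ.* w ℤ.+ S)
    ≡⟨ cong (ℤ._+_ ℤ.1ℤ) (weight+sum-sign bs) ⟩
  ℤ.1ℤ ℤ.+ + length bs
    ∎
  where open +-*-Solver
        w = + weight bs; S = sumℤ (map sign bs)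

twice-weight : ∀ bs → + 2 ℤ.* + weight bs ≡ + length bs ℤ.- sumℤ (map sign bs)
twice-weight bs = begin
  + 2 ℤ.* w                ≡⟨ solve 2 (λ w S → con (+ 2) :* w := (con (+ 2) :* w :+ S) :- S) refl w S ⟩
  (+ 2 ℤ.* w ℤ.+ S) ℤ.- S  ≡⟨ cong (ℤ._- S) (weight+sum-sign bs) ⟩
  + length bs ℤ.- S        ∎
  where open +-*-Solver
        w = + weight bs; S = sumℤ (map sign bs)

sumℤ-++ : ∀ (xs ys : List ℤ) → sumℤ (xs ++ ys) ≡ sumℤ xs ℤ.+ sumℤ ys
sumℤ-++ []       ys = sym (ℤ.+-identityˡ _)
sumℤ-++ (x ∷ xs) ys = trans (cong (ℤ._+_ x) (sumℤ-++ xs ys)) (sym (ℤ.+-assoc x _ _))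

sumℤ-concatMap : ∀ (f : B → ℤ) (g : A → List B) xs →
                 sumℤ (map f (concatMap g xs)) ≡ sumℤ (map (λ x → sumℤ (map f (g x))) xs)
sumℤ-concatMap f g []       = refl
sumℤ-concatMap f g (x ∷ xs) = begin
  sumℤ (map f (g x ++ concatMap g xs))
    ≡⟨ cong sumℤ (List.map-++ f (g x) _) ⟩
  sumℤ (map f (g x) ++ map f (concatMap g xs))
    ≡⟨ sumℤ-++ (map f (g x)) _ ⟩
  sumℤ (map f (g x)) ℤ.+ sumℤ (map f (concatMap g xs))
    ≡⟨ cong (ℤ._+_ (sumℤ (map f (g x)))) (sumℤ-concatMap f g xs) ⟩
  sumℤ (map f (g x)) ℤ.+ sumℤ (map (λ y → sumℤ (map f (g y))) xs)
    ∎

sumℤ-cong-All : ∀ {P : Pred A 0ℓ} {f g : A → ℤ} {xs} → (∀ {x} → P x → f x ≡ g x) →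
                All P xs → sumℤ (map f xs) ≡ sumℤ (map g xs)
sumℤ-cong-All f≡g []         = refl
sumℤ-cong-All f≡g (px ∷ pxs) = cong₂ ℤ._+_ (f≡g px) (sumℤ-cong-All f≡g pxs)

sumℤ-filter : ∀ {P : Pred A 0ℓ} (P? : Decidable P) (f : A → ℤ) xs →
              sumℤ (map f (filter P? xs)) ≡ sumℤ (map (λ x → if does (P? x) then f x else ℤ.0ℤ) xs)
sumℤ-filter P? f []       = refl
sumℤ-filter P? f (x ∷ xs) with does (P? x)
... | true  = cong (ℤ._+_ (f x)) (sumℤ-filter P? f xs)
... | false = trans (sumℤ-filter P? f xs) (sym (ℤ.+-identityˡ _))

sumℤ-const-1 : ∀ (xs : List A) → sumℤ (map (const ℤ.1ℤ) xs) ≡ + length xs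
sumℤ-const-1 []       = refl
sumℤ-const-1 (x ∷ xs) = cong (ℤ._+_ ℤ.1ℤ) (sumℤ-const-1 xs)

module _ where
  open import Algebra.Properties.CommutativeMonoid.Sum ℤ.+-0-commutativeMonoid using (sum)
  open import Algebra.Definitions.RawMonoid ℤ.+-0-rawMonoid using (_×_)

  sumℤ-tabulate : ∀ {n} (h : Fin n → ℤ) → sumℤ (tabulate h) ≡ sum h
  sumℤ-tabulate {zero}  h = refl
  sumℤ-tabulate {suc n} h = cong (ℤ._+_ (h Fin.zero)) (sumℤ-tabulate (h ∘ Fin.suc))

  ×-1ℤ : ∀ n → n × ℤ.1ℤ ≡ + n
  ×-1ℤ zero    = refl
  ×-1ℤ (suc n) = cong (ℤ._+_ ℤ.1ℤ) (×-1ℤ n)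

length-concatMap-const : ∀ (g : A → List B) {m} → (∀ x → length (g x) ≡ m) →
                         ∀ xs → length (concatMap g xs) ≡ length xs ℕ.* m
length-concatMap-const g eq []       = refl
length-concatMap-const g eq (x ∷ xs) =
  trans (List.length-++ (g x)) (cong₂ ℕ._+_ (eq x) (length-concatMap-const g eq xs))

length-tuples : ∀ k (xs : List A) → length (tuples k xs) ≡ length xs ℕ.^ k
length-tuples zero    xs = refl
length-tuples (suc k) xs =
  length-concatMap-const (λ x → map (x ∷_) (tuples k xs))
    (λ x → trans (List.length-map (x ∷_) (tuples k xs)) (length-tuples k xs)) xs

module _ (M : CommutativeMonoid 0ℓ 0ℓ) where
  open CommutativeMonoid M using (_≈_; ε; identityˡ; ∙-congˡ; rawMonoid) renaming (trans to ≈-trans)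
  open import Algebra.Properties.CommutativeMonoid.Sum M using (sum; sum-replicate)
  open import Algebra.Definitions.RawMonoid rawMonoid using (_×_)

  sum-except : ∀ {n} (j : Fin n) x → sum (λ i → if does (i Fin.≟ j) then ε else x) ≈ (n ∸ 1) × x
  sum-except {suc n}       Fin.zero    x = ≈-trans (identityˡ _) (sum-replicate n)
  sum-except {suc (suc n)} (Fin.suc j) x = ∙-congˡ (sum-except j x)

suc-∸1 : ∀ {n} → 0 < n → suc (n ∸ 1) ≡ n
suc-∸1 {suc n} _ = refl

no-field-with-one-element : ¬ FiniteField 1
no-field-with-one-element F = 0≢1 (begin
  0#                ≡⟨ sym (strictlyInverseˡ 0#) ⟩
  to (from 0#)      ≡⟨ cong to (Fin-1-unique (from 0#) (from 1#)) ⟩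
  to (from 1#)      ≡⟨ strictlyInverseˡ 1# ⟩
  1#                ∎)
  where
  open FiniteField F; open Inverse enum
  Fin-1-unique : (i j : Fin 1) → i ≡ j
  Fin-1-unique Fin.zero Fin.zero = refl

module FiniteFieldProperties {q : ℕ} (F : FiniteField q) where
  open FiniteField F
  open Inverse using (to; from; strictlyInverseˡ; strictlyInverseʳ)
  open IsCommutativeRing isCommutativeRing
    using (*-assoc; *-comm; *-identityˡ; *-identityʳ; distribˡ; zeroˡ; zeroʳ)

  ring : CommutativeRing 0ℓ 0ℓ
  ring = record
    { Carrier = Carrier; _≈_ = _≡_; _+_ = _+_; _*_ = _*_; -_ = -_; 0# = 0#; 1# = 1#
    ; isCommutativeRing = isCommutativeRing }

  open CommutativeRing ring using (*-commutativeMonoid; *-commutativeSemigroup; commutativeSemiring)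
  open import Algebra.Properties.CommutativeSemiring.Exp commutativeSemiring public
    using (_^_; ^-assocʳ; ^-distrib-*)
  open import Algebra.Properties.CommutativeSemigroup *-commutativeSemigroup using (interchange)

  1≢0 : 1# ≢ 0#
  1≢0 = 0≢1 ∘ sym

  ⁻¹-inverseˡ : ∀ {x} → x ≢ 0# → x ⁻¹ * x ≡ 1#
  ⁻¹-inverseˡ {x} x≢0 = trans (*-comm (x ⁻¹) x) (⁻¹-inverse x x≢0)

  ⁻¹-cancelˡ : ∀ {x} → x ≢ 0# → ∀ y → x ⁻¹ * (x * y) ≡ y
  ⁻¹-cancelˡ {x} x≢0 y = begin
    x ⁻¹ * (x * y)  ≡⟨ sym (*-assoc _ _ _) ⟩
    x ⁻¹ * x * y    ≡⟨ cong (_* y) (⁻¹-inverseˡ x≢0) ⟩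
    1# * y          ≡⟨ *-identityˡ y ⟩
    y               ∎

  ⁻¹-cancelʳ : ∀ {x} → x ≢ 0# → ∀ y → x * (x ⁻¹ * y) ≡ y
  ⁻¹-cancelʳ {x} x≢0 y = begin
    x * (x ⁻¹ * y)  ≡⟨ sym (*-assoc _ _ _) ⟩
    x * x ⁻¹ * y    ≡⟨ cong (_* y) (⁻¹-inverse x x≢0) ⟩
    1# * y          ≡⟨ *-identityˡ y ⟩
    y               ∎

  *-cancelʳ : ∀ {p} → p ≢ 0# → ∀ {u v} → u * p ≡ v * p → u ≡ v
  *-cancelʳ {p} p≢0 {u} {v} up≡vp = begin
    u               ≡⟨ sym (⁻¹-cancelˡ p≢0 u) ⟩
    p ⁻¹ * (p * u)  ≡⟨ cong (λ z → p ⁻¹ * z) (trans (*-comm p u) (trans up≡vp (*-comm v p))) ⟩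
    p ⁻¹ * (p * v)  ≡⟨ ⁻¹-cancelˡ p≢0 v ⟩
    v               ∎

  *-nonzero : ∀ {x y} → x ≢ 0# → y ≢ 0# → x * y ≢ 0#
  *-nonzero {x} {y} x≢0 y≢0 xy≡0 = y≢0 (begin
    y               ≡⟨ sym (⁻¹-cancelˡ x≢0 y) ⟩
    x ⁻¹ * (x * y)  ≡⟨ cong (x ⁻¹ *_) xy≡0 ⟩
    x ⁻¹ * 0#       ≡⟨ zeroʳ _ ⟩
    0#              ∎)

  ⁻¹-unique : ∀ {x y} → x ≢ 0# → x * y ≡ 1# → y ≡ x ⁻¹
  ⁻¹-unique {x} {y} x≢0 xy≡1 = begin
    y               ≡⟨ sym (⁻¹-cancelˡ x≢0 y) ⟩
    x ⁻¹ * (x * y)  ≡⟨ cong (x ⁻¹ *_) xy≡1 ⟩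
    x ⁻¹ * 1#       ≡⟨ *-identityʳ _ ⟩
    x ⁻¹            ∎

  ⁻¹-distrib-* : ∀ {x y} → x ≢ 0# → y ≢ 0# → (x * y) ⁻¹ ≡ x ⁻¹ * y ⁻¹
  ⁻¹-distrib-* {x} {y} x≢0 y≢0 = sym (⁻¹-unique (*-nonzero x≢0 y≢0) (begin
    x * y * (x ⁻¹ * y ⁻¹)      ≡⟨ interchange x y (x ⁻¹) (y ⁻¹) ⟩
    x * x ⁻¹ * (y * y ⁻¹)      ≡⟨ cong₂ _*_ (⁻¹-inverse x x≢0) (⁻¹-inverse y y≢0) ⟩
    1# * 1#                    ≡⟨ *-identityˡ 1# ⟩
    1#                         ∎))

  *-bijection : ∀ {x} → x ≢ 0# → Carrier ↔ Carrier
  *-bijection {x} x≢0 = mk↔ₛ′ (x *_) (x ⁻¹ *_) (⁻¹-cancelʳ x≢0) (⁻¹-cancelˡ x≢0)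

  element : Fin q → Carrier
  element = to enum

  index : Carrier → Fin q
  index = from enum

  isUnit : Carrier → Bool
  isUnit y = does (¬? (y ≟ 0#))

  module _ (M : CommutativeMonoid 0ℓ 0ℓ) where
    open CommutativeMonoid M using (ε; rawMonoid)
      renaming (Carrier to |M|; _≈_ to _≈ᴹ_; trans to ≈-trans; reflexive to ≈-reflexive)
    open import Algebra.Properties.CommutativeMonoid.Sum M using (sum; sum-cong-≗; sum-permute)
    open import Algebra.Definitions.RawMonoid rawMonoid using (_×_)

    -- Extending by ε at 0 turns sums over F_q^* into sums over Fin q, where permutations act.
    onUnits : (Carrier → |M|) → Carrier → |M|
    onUnits h y = if isUnit y then h y else ε

    onUnits-element : ∀ h i → onUnits h (element i) ≡ (if does (i Fin.≟ index 0#) then ε else h (element i))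
    onUnits-element h i with element i ≟ 0# | i Fin.≟ index 0#
    ... | yes _    | yes _   = refl
    ... | no _     | no _    = refl
    ... | yes ei≡0 | no i≢i₀ = ⊥-elim (i≢i₀ (trans (sym (strictlyInverseʳ enum i)) (cong index ei≡0)))
    ... | no ei≢0  | yes i≡i₀ = ⊥-elim (ei≢0 (trans (cong element i≡i₀) (strictlyInverseˡ enum 0#)))

    sum-onUnits-const : ∀ x → sum (onUnits (const x) ∘ element) ≈ᴹ (q ∸ 1) × x
    sum-onUnits-const x =
      ≈-trans (≈-reflexive (sum-cong-≗ (onUnits-element (const x)))) (sum-except M (index 0#) x)

    sum-reindex : (φ : Carrier ↔ Carrier) (h : Carrier → |M|) →
                  sum (h ∘ element) ≈ᴹ sum (h ∘ to φ ∘ element)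
    sum-reindex φ h = ≈-trans (sum-permute (h ∘ element) (↔-sym enum ↔-∘ (φ ↔-∘ enum)))
      (≈-reflexive (sum-cong-≗ (λ i → cong h (strictlyInverseˡ enum (to φ (element i))))))

    onUnits-reindex : (φ : Carrier ↔ Carrier) → to φ 0# ≡ 0# →
                      ∀ h y → onUnits h (to φ y) ≡ onUnits (h ∘ to φ) y
    onUnits-reindex φ φ0≡0 h y with y ≟ 0# | to φ y ≟ 0#
    ... | yes _   | yes _    = refl
    ... | no _    | no _     = refl
    ... | yes y≡0 | no φy≢0  = ⊥-elim (φy≢0 (trans (cong (to φ) y≡0) φ0≡0))
    ... | no y≢0  | yes φy≡0 = ⊥-elim (y≢0 (begin
      y                 ≡⟨ sym (strictlyInverseʳ φ y) ⟩
      from φ (to φ y)   ≡⟨ cong (from φ) (trans φy≡0 (sym φ0≡0)) ⟩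
      from φ (to φ 0#)  ≡⟨ strictlyInverseʳ φ 0# ⟩
      0#                ∎))

  ℤ+ : CommutativeMonoid 0ℓ 0ℓ
  ℤ+ = ℤ.+-0-commutativeMonoid

  module _ where
    open import Algebra.Properties.CommutativeMonoid.Sum ℤ+ using (sum; sum-cong-≗)

    sumUnits : (Carrier → ℤ) → ℤ
    sumUnits g = sumℤ (map g (nonzeros F))

    sumUnits-as-sum : ∀ g → sumUnits g ≡ sum (onUnits ℤ+ g ∘ element)
    sumUnits-as-sum g = begin
      sumUnits g
        ≡⟨ sumℤ-filter (λ x → ¬? (x ≟ 0#)) g (map element (allFin q)) ⟩
      sumℤ (map (onUnits ℤ+ g) (map element (allFin q)))
        ≡⟨ cong sumℤ (sym (List.map-∘ {g = onUnits ℤ+ g} (allFin q))) ⟩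
      sumℤ (map (onUnits ℤ+ g ∘ element) (allFin q))
        ≡⟨ cong sumℤ (List.map-tabulate id (onUnits ℤ+ g ∘ element)) ⟩
      sumℤ (tabulate (onUnits ℤ+ g ∘ element))
        ≡⟨ sumℤ-tabulate (onUnits ℤ+ g ∘ element) ⟩
      sum (onUnits ℤ+ g ∘ element)
        ∎

    length-nonzeros : length (nonzeros F) ≡ q ∸ 1
    length-nonzeros = ℤ.+-injective (begin
      + length (nonzeros F)   ≡⟨ sym (sumℤ-const-1 (nonzeros F)) ⟩
      sumUnits (const ℤ.1ℤ)   ≡⟨ sumUnits-as-sum (const ℤ.1ℤ) ⟩
      _                       ≡⟨ sum-onUnits-const ℤ+ ℤ.1ℤ ⟩
      _                       ≡⟨ ×-1ℤ (q ∸ 1) ⟩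
      + (q ∸ 1)               ∎)

    sumUnits-reindex : (φ : Carrier ↔ Carrier) → to φ 0# ≡ 0# →
                       ∀ g → sumUnits g ≡ sumUnits (g ∘ to φ)
    sumUnits-reindex φ φ0≡0 g = begin
      sumUnits g                             ≡⟨ sumUnits-as-sum g ⟩
      sum (onUnits ℤ+ g ∘ element)           ≡⟨ sum-reindex ℤ+ φ (onUnits ℤ+ g) ⟩
      sum (onUnits ℤ+ g ∘ to φ ∘ element)    ≡⟨ sum-cong-≗ (onUnits-reindex ℤ+ φ φ0≡0 g ∘ element) ⟩
      sum (onUnits ℤ+ (g ∘ to φ) ∘ element)  ≡⟨ sym (sumUnits-as-sum (g ∘ to φ)) ⟩
      sumUnits (g ∘ to φ)                    ∎

  sumUnits-cong : ∀ {g h} → (∀ {x} → x ≢ 0# → g x ≡ h x) → sumUnits g ≡ sumUnits h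
  sumUnits-cong g≡h = sumℤ-cong-All g≡h (All.all-filter (λ x → ¬? (x ≟ 0#)) (map element (allFin q)))

  sumUnitTuples : ∀ k → (Vec Carrier k → ℤ) → ℤ
  sumUnitTuples k f = sumℤ (map f (tuples k (nonzeros F)))

  sumUnitTuples-suc : ∀ k f → sumUnitTuples (suc k) f ≡ sumUnits (λ x → sumUnitTuples k (f ∘ (x ∷_)))
  sumUnitTuples-suc k f = trans (sumℤ-concatMap f (λ x → map (x ∷_) T) (nonzeros F))
    (cong sumℤ (List.map-cong (λ x → cong sumℤ (sym (List.map-∘ {g = f} T))) (nonzeros F)))
    where T = tuples k (nonzeros F)

  sumUnitTuples-cong : ∀ k {f g} → (∀ {α} → VecAll.All (_≢ 0#) α → f α ≡ g α) →
                       sumUnitTuples k f ≡ sumUnitTuples k g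
  sumUnitTuples-cong zero    f≡g = cong (λ z → z ℤ.+ ℤ.0ℤ) (f≡g VecAll.[])
  sumUnitTuples-cong (suc k) {f} {g} f≡g = begin
    sumUnitTuples (suc k) f
      ≡⟨ sumUnitTuples-suc k f ⟩
    sumUnits (λ x → sumUnitTuples k (f ∘ (x ∷_)))
      ≡⟨ sumUnits-cong (λ x≢0 → sumUnitTuples-cong k (λ α≢0 → f≡g (x≢0 VecAll.∷ α≢0))) ⟩
    sumUnits (λ x → sumUnitTuples k (g ∘ (x ∷_)))
      ≡⟨ sym (sumUnitTuples-suc k g) ⟩
    sumUnitTuples (suc k) g
      ∎

  sumUnitTuples-reindex : (φ : Carrier ↔ Carrier) → to φ 0# ≡ 0# →
                          ∀ k f → sumUnitTuples k f ≡ sumUnitTuples k (f ∘ Vec.map (to φ))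
  sumUnitTuples-reindex φ φ0≡0 zero    f = refl
  sumUnitTuples-reindex φ φ0≡0 (suc k) f = begin
    sumUnitTuples (suc k) f
      ≡⟨ sumUnitTuples-suc k f ⟩
    sumUnits (λ x → sumUnitTuples k (f ∘ (x ∷_)))
      ≡⟨ sumUnits-reindex φ φ0≡0 _ ⟩
    sumUnits (λ x → sumUnitTuples k (f ∘ (to φ x ∷_)))
      ≡⟨ cong sumℤ (List.map-cong (λ x → sumUnitTuples-reindex φ φ0≡0 k (f ∘ (to φ x ∷_))) (nonzeros F)) ⟩
    sumUnits (λ x → sumUnitTuples k (f ∘ (to φ x ∷_) ∘ Vec.map (to φ)))
      ≡⟨ sym (sumUnitTuples-suc k _) ⟩
    sumUnitTuples (suc k) (f ∘ Vec.map (to φ))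
      ∎

  module _ where
    open import Algebra.Properties.CommutativeMonoid.Sum *-commutativeMonoid
      using () renaming (sum to ∏; sum-cong-≗ to ∏-cong-≗; ∑-distrib-+ to ∏-distrib-*)

    unitOrOne : Carrier → Carrier
    unitOrOne = onUnits *-commutativeMonoid id

    unitOrOne-nonzero : ∀ y → unitOrOne y ≢ 0#
    unitOrOne-nonzero y with y ≟ 0#
    ... | yes _   = 1≢0
    ... | no y≢0  = y≢0

    unitOrOne-* : ∀ {x} → x ≢ 0# → ∀ y →
                  unitOrOne (x * y) ≡ onUnits *-commutativeMonoid (const x) y * unitOrOne y
    unitOrOne-* {x} x≢0 y with y ≟ 0# | (x * y) ≟ 0#
    ... | yes _   | yes _    = sym (*-identityˡ 1#)
    ... | no _    | no _     = refl
    ... | yes y≡0 | no xy≢0  = ⊥-elim (xy≢0 (trans (cong (x *_) y≡0) (zeroʳ x)))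
    ... | no y≢0  | yes xy≡0 = ⊥-elim (*-nonzero x≢0 y≢0 xy≡0)

    ∏-nonzero : ∀ {n} (f : Fin n → Carrier) → (∀ i → f i ≢ 0#) → ∏ f ≢ 0#
    ∏-nonzero {zero}  f f≢0 = 1≢0
    ∏-nonzero {suc n} f f≢0 = *-nonzero (f≢0 Fin.zero) (∏-nonzero (f ∘ Fin.suc) (f≢0 ∘ Fin.suc))

    fermat-units : ∀ {x} → x ≢ 0# → x ^ (q ∸ 1) ≡ 1#
    fermat-units {x} x≢0 = sym (*-cancelʳ P≢0 (begin
      1# * P                                      ≡⟨ *-identityˡ P ⟩
      P                                           ≡⟨ sum-reindex *-commutativeMonoid (*-bijection x≢0) unitOrOne ⟩
      ∏ (λ i → unitOrOne (x * element i))         ≡⟨ ∏-cong-≗ (unitOrOne-* x≢0 ∘ element) ⟩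
      ∏ (λ i → xOnUnits (element i) * unitOrOne (element i))
                                                  ≡⟨ ∏-distrib-* (xOnUnits ∘ element) (unitOrOne ∘ element) ⟩
      ∏ (xOnUnits ∘ element) * P                  ≡⟨ cong (_* P) (sum-onUnits-const *-commutativeMonoid x) ⟩
      x ^ (q ∸ 1) * P                             ∎))
      where
      P = ∏ (unitOrOne ∘ element)
      P≢0 = ∏-nonzero (unitOrOne ∘ element) (unitOrOne-nonzero ∘ element)
      xOnUnits = onUnits *-commutativeMonoid (const x)

  fermat : ∀ x → x ^ q ≡ x
  fermat x = trans (cong (x ^_) (sym (suc-∸1 0<q))) (x*x^[q-1]≡x (x ≟ 0#))
    where
    0<q : 0 < q
    0<q = ℕ.>-nonZero⁻¹ q {{Fin.nonZeroIndex (index 0#)}}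
    x*x^[q-1]≡x : Dec (x ≡ 0#) → x * x ^ (q ∸ 1) ≡ x
    x*x^[q-1]≡x (yes x≡0) = trans (cong (_* x ^ (q ∸ 1)) x≡0) (trans (zeroˡ _) (sym x≡0))
    x*x^[q-1]≡x (no x≢0)  = trans (cong (x *_) (fermat-units x≢0)) (*-identityʳ x)

  1^n≡1 : ∀ n → 1# ^ n ≡ 1#
  1^n≡1 zero    = refl
  1^n≡1 (suc n) = trans (*-identityˡ _) (1^n≡1 n)

  x^[1+k]*x⁻¹^k≡x : ∀ {x} → x ≢ 0# → ∀ k → x ^ suc k * x ⁻¹ ^ k ≡ x
  x^[1+k]*x⁻¹^k≡x {x} x≢0 k = begin
    x * x ^ k * x ⁻¹ ^ k       ≡⟨ *-assoc x _ _ ⟩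
    x * (x ^ k * x ⁻¹ ^ k)     ≡⟨ cong (x *_) (sym (^-distrib-* x (x ⁻¹) k)) ⟩
    x * (x * x ⁻¹) ^ k         ≡⟨ cong (λ y → x * y ^ k) (⁻¹-inverse x x≢0) ⟩
    x * 1# ^ k                 ≡⟨ cong (x *_) (1^n≡1 k) ⟩
    x * 1#                     ≡⟨ *-identityʳ x ⟩
    x                          ∎

  sumF-map-* : ∀ a {k} (α : Vec Carrier k) → sumF F (Vec.map (a *_) α) ≡ a * sumF F α
  sumF-map-* a []      = sym (zeroʳ a)
  sumF-map-* a (x ∷ α) = trans (cong (_+_ (a * x)) (sumF-map-* a α)) (sym (distribˡ a x _))

  prodInv-map-* : ∀ {a} → a ≢ 0# → ∀ {k} {α : Vec Carrier k} → VecAll.All (_≢ 0#) α →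
                  prodInv F (Vec.map (a *_) α) ≡ a ⁻¹ ^ k * prodInv F α
  prodInv-map-* a≢0 VecAll.[] = sym (*-identityˡ 1#)
  prodInv-map-* {a} a≢0 {suc k} {x ∷ α} (x≢0 VecAll.∷ α≢0) = begin
    (a * x) ⁻¹ * prodInv F (Vec.map (a *_) α)        ≡⟨ cong₂ _*_ (⁻¹-distrib-* a≢0 x≢0) (prodInv-map-* a≢0 α≢0) ⟩
    a ⁻¹ * x ⁻¹ * (a ⁻¹ ^ k * prodInv F α)           ≡⟨ interchange (a ⁻¹) (x ⁻¹) _ _ ⟩
    a ⁻¹ * a ⁻¹ ^ k * (x ⁻¹ * prodInv F α)           ∎

  Kloosterman-scale : ∀ r k {a} → a ≢ 0# →
                      Kloosterman F r k (a ^ suc k) ≡ sumUnitTuples k (λ α → lam F r (a * (sumF F α + prodInv F α)))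
  Kloosterman-scale r k {a} a≢0 =
    trans (sumUnitTuples-reindex (*-bijection a≢0) (zeroʳ a) k _)
          (sumUnitTuples-cong k (cong (lam F r) ∘ scaled-argument))
    where
    scaled-argument : ∀ {α} → VecAll.All (_≢ 0#) α →
                      sumF F (Vec.map (a *_) α) + a ^ suc k * prodInv F (Vec.map (a *_) α)
                        ≡ a * (sumF F α + prodInv F α)
    scaled-argument {α} α≢0 = begin
      sumF F (Vec.map (a *_) α) + a ^ suc k * prodInv F (Vec.map (a *_) α)
        ≡⟨ cong₂ (λ s p → s + a ^ suc k * p) (sumF-map-* a α) (prodInv-map-* a≢0 α≢0) ⟩
      a * sumF F α + a ^ suc k * (a ⁻¹ ^ k * prodInv F α)
        ≡⟨ cong (_+_ (a * sumF F α)) (sym (*-assoc _ _ _)) ⟩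
      a * sumF F α + a ^ suc k * a ⁻¹ ^ k * prodInv F α
        ≡⟨ cong (λ c → a * sumF F α + c * prodInv F α) (x^[1+k]*x⁻¹^k≡x a≢0 k) ⟩
      a * sumF F α + a * prodInv F α
        ≡⟨ sym (distribˡ a _ _) ⟩
      a * (sumF F α + prodInv F α) ∎

  sum-sign-codeword : ∀ r k {a} → a ≢ 0# → sumℤ (map sign (codeword F r k a)) ≡ Kloosterman F r k (a ^ suc k)
  sum-sign-codeword r k {a} a≢0 =
    trans (cong sumℤ (sym (List.map-∘ {g = sign} (tuples k (nonzeros F))))) (sym (Kloosterman-scale r k a≢0))

  length-codeword : ∀ r k a → length (codeword F r k a) ≡ (q ∸ 1) ℕ.^ k
  length-codeword r k a = begin
    length (codeword F r k a)       ≡⟨ List.length-map _ (tuples k (nonzeros F)) ⟩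
    length (tuples k (nonzeros F))  ≡⟨ length-tuples k (nonzeros F) ⟩
    length (nonzeros F) ℕ.^ k       ≡⟨ cong (ℕ._^ k) length-nonzeros ⟩
    (q ∸ 1) ℕ.^ k                   ∎

module CharacteristicTwo (r : ℕ) (F : FiniteField (2 ℕ.^ suc r)) where
  open FiniteField F
  open FiniteFieldProperties F
  open CommutativeRing ring
    using (+-comm; +-identityʳ; -‿inverseʳ; +-assoc; *-identityʳ; distribˡ; zeroʳ; +-group)
  open import Algebra.Properties.Ring (CommutativeRing.ring ring) using (-‿involutive; -1*x≈-x)
  open import Algebra.Properties.Group +-group using (∙-cancelˡ)
  open import Algebra.Properties.CommutativeSemigroup (CommutativeRing.*-commutativeSemigroup ring) using (interchange)
  import Algebra.Solver.Ring.NaturalCoefficients.Default (CommutativeRing.commutativeSemiring ring) as Solver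

  [y*y]^n≡y^[2*n] : ∀ y n → (y * y) ^ n ≡ y ^ (2 ℕ.* n)
  [y*y]^n≡y^[2*n] y n = trans (cong (λ z → (y * z) ^ n) (sym (*-identityʳ y))) (^-assocʳ y 2 n)

  y^n*y^n≡y^[2*n] : ∀ y n → y ^ n * y ^ n ≡ y ^ (2 ℕ.* n)
  y^n*y^n≡y^[2*n] y n = trans (sym (^-distrib-* y y n)) ([y*y]^n≡y^[2*n] y n)

  -1≡1 : - 1# ≡ 1#
  -1≡1 = begin
    - 1#                        ≡⟨ sym (fermat (- 1#)) ⟩
    (- 1#) ^ (2 ℕ.* 2 ℕ.^ r)    ≡⟨ sym ([y*y]^n≡y^[2*n] (- 1#) (2 ℕ.^ r)) ⟩
    (- 1# * - 1#) ^ (2 ℕ.^ r)   ≡⟨ cong (_^ (2 ℕ.^ r)) (trans (-1*x≈-x (- 1#)) (-‿involutive 1#)) ⟩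
    1# ^ (2 ℕ.^ r)              ≡⟨ 1^n≡1 (2 ℕ.^ r) ⟩
    1#                          ∎

  x+x≡0 : ∀ x → x + x ≡ 0#
  x+x≡0 x = begin
    x + x                ≡⟨ sym (cong₂ _+_ (*-identityʳ x) (*-identityʳ x)) ⟩
    x * 1# + x * 1#      ≡⟨ sym (distribˡ x 1# 1#) ⟩
    x * (1# + 1#)        ≡⟨ cong (λ z → x * (1# + z)) (sym -1≡1) ⟩
    x * (1# + - 1#)      ≡⟨ cong (x *_) (-‿inverseʳ 1#) ⟩
    x * 0#               ≡⟨ zeroʳ x ⟩
    0#                   ∎

  square-+ : ∀ x y → (x + y) * (x + y) ≡ x * x + y * y
  square-+ x y = begin
    (x + y) * (x + y)
      ≡⟨ solve 2 (λ x y → (x :+ y) :* (x :+ y) := (x :* x :+ y :* y) :+ (x :* y :+ x :* y)) refl x y ⟩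
    (x * x + y * y) + (x * y + x * y)
      ≡⟨ cong (_+_ (x * x + y * y)) (x+x≡0 (x * y)) ⟩
    (x * x + y * y) + 0#
      ≡⟨ +-identityʳ _ ⟩
    x * x + y * y
      ∎
    where open Solver

  trace-suc : ∀ k y → trace F (suc k) y ≡ trace F k y + y ^ (2 ℕ.^ k)
  trace-suc zero    y = trans (+-comm y 0#) (cong (_+_ 0#) (sym (*-identityʳ y)))
  trace-suc (suc k) y = begin
    y + trace F (suc k) (y * y)
      ≡⟨ cong (_+_ y) (trace-suc k (y * y)) ⟩
    y + (trace F k (y * y) + (y * y) ^ (2 ℕ.^ k))
      ≡⟨ sym (+-assoc y _ _) ⟩
    trace F (suc k) y + (y * y) ^ (2 ℕ.^ k)
      ≡⟨ cong (_+_ (trace F (suc k) y)) ([y*y]^n≡y^[2*n] y (2 ℕ.^ k)) ⟩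
    trace F (suc k) y + y ^ (2 ℕ.^ suc k)
      ∎

  trace-square : ∀ y → trace F (suc r) (y * y) ≡ trace F (suc r) y
  trace-square y = ∙-cancelˡ y _ _ (begin
    y + trace F (suc r) (y * y)              ≡⟨ trace-suc (suc r) y ⟩
    trace F (suc r) y + y ^ (2 ℕ.^ suc r)    ≡⟨ cong (_+_ (trace F (suc r) y)) (fermat y) ⟩
    trace F (suc r) y + y                    ≡⟨ +-comm _ y ⟩
    y + trace F (suc r) y                    ∎)

  lam-square : ∀ y → lam F (suc r) (y * y) ≡ lam F (suc r) y
  lam-square y = cong (λ t → sign (does (¬? (t ≟ 0#)))) (trace-square y)

  square-bijection : Carrier ↔ Carrier
  square-bijection = mk↔ₛ′ (λ y → y * y) (_^ (2 ℕ.^ r))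
    (λ y → trans (y^n*y^n≡y^[2*n] y (2 ℕ.^ r)) (fermat y))
    (λ y → trans ([y*y]^n≡y^[2*n] y (2 ℕ.^ r)) (fermat y))

  sumF-map-square : ∀ {k} (α : Vec Carrier k) → sumF F (Vec.map (λ y → y * y) α) ≡ sumF F α * sumF F α
  sumF-map-square []      = sym (zeroʳ 0#)
  sumF-map-square (x ∷ α) = trans (cong (_+_ (x * x)) (sumF-map-square α)) (sym (square-+ x (sumF F α)))

  prodInv-map-square : ∀ {k} {α : Vec Carrier k} → VecAll.All (_≢ 0#) α →
                       prodInv F (Vec.map (λ y → y * y) α) ≡ prodInv F α * prodInv F α
  prodInv-map-square VecAll.[] = sym (*-identityʳ 1#)
  prodInv-map-square {α = x ∷ α} (x≢0 VecAll.∷ α≢0) =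
    trans (cong₂ _*_ (⁻¹-distrib-* x≢0 x≢0) (prodInv-map-square α≢0)) (interchange (x ⁻¹) (x ⁻¹) _ _)

  Kloosterman-square : ∀ k b → Kloosterman F (suc r) k (b * b) ≡ Kloosterman F (suc r) k b
  Kloosterman-square k b =
    trans (sumUnitTuples-reindex square-bijection (zeroʳ 0#) k _)
          (sumUnitTuples-cong k (λ α≢0 → trans (cong (lam F (suc r)) (squared-argument α≢0)) (lam-square _)))
    where
    squared-argument : ∀ {α} → VecAll.All (_≢ 0#) α →
                       sumF F (Vec.map (λ y → y * y) α) + b * b * prodInv F (Vec.map (λ y → y * y) α)
                         ≡ (sumF F α + b * prodInv F α) * (sumF F α + b * prodInv F α)
    squared-argument {α} α≢0 = begin
      sumF F (Vec.map (λ y → y * y) α) + b * b * prodInv F (Vec.map (λ y → y * y) α)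
        ≡⟨ cong₂ (λ s p → s + b * b * p) (sumF-map-square α) (prodInv-map-square α≢0) ⟩
      sumF F α * sumF F α + b * b * (prodInv F α * prodInv F α)
        ≡⟨ cong (_+_ (sumF F α * sumF F α)) (interchange b b _ _) ⟩
      sumF F α * sumF F α + b * prodInv F α * (b * prodInv F α)
        ≡⟨ sym (square-+ (sumF F α) (b * prodInv F α)) ⟩
      (sumF F α + b * prodInv F α) * (sumF F α + b * prodInv F α) ∎

  Kloosterman-pow2 : ∀ k s b → Kloosterman F (suc r) k (b ^ (2 ℕ.^ s)) ≡ Kloosterman F (suc r) k b
  Kloosterman-pow2 k zero    b = cong (Kloosterman F (suc r) k) (*-identityʳ b)
  Kloosterman-pow2 k (suc s) b = begin
    K (b ^ (2 ℕ.* 2 ℕ.^ s))                ≡⟨ cong K (sym (y^n*y^n≡y^[2*n] b (2 ℕ.^ s))) ⟩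
    K (b ^ (2 ℕ.^ s) * b ^ (2 ℕ.^ s))      ≡⟨ Kloosterman-square k (b ^ (2 ℕ.^ s)) ⟩
    K (b ^ (2 ℕ.^ s))                      ≡⟨ Kloosterman-pow2 k s b ⟩
    K b                                    ∎
    where K = Kloosterman F (suc r) k

  sum-sign-codeword≡Kloosterman : ∀ s {a} → a ≢ 0# →
    sumℤ (map sign (codeword F (suc r) (2 ℕ.^ s ∸ 1) a)) ≡ Kloosterman F (suc r) (2 ℕ.^ s ∸ 1) a
  sum-sign-codeword≡Kloosterman s {a} a≢0 = begin
    sumℤ (map sign (codeword F (suc r) k a))  ≡⟨ sum-sign-codeword (suc r) k a≢0 ⟩
    K (a ^ suc k)                             ≡⟨ cong (λ m → K (a ^ m)) (suc-∸1 (ℕ.m^n>0 2 s)) ⟩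
    K (a ^ (2 ℕ.^ s))                         ≡⟨ Kloosterman-pow2 k s a ⟩
    K a                                       ∎
    where k = 2 ℕ.^ s ∸ 1
          K = Kloosterman F (suc r) k

open import Data.Nat using (_^_)
open import Data.Integer using (_*_; _-_)

lemma12 : (r s : ℕ) → 0 < s → (F : FiniteField (2 ^ r)) →
          (a : FiniteField.Carrier F) → a ≢ FiniteField.0# F →
          (+ 2) * (+ weight (codeword F r (2 ^ s ∸ 1) a))
            ≡ (+ ((2 ^ r ∸ 1) ^ (2 ^ s ∸ 1))) - Kloosterman F r (2 ^ s ∸ 1) a
lemma12 zero    s _ F a a≢0 = ⊥-elim (no-field-with-one-element F)
lemma12 (suc r) s _ F a a≢0 = begin
  + 2 * + weight c
    ≡⟨ twice-weight c ⟩
  + length c - sumℤ (map sign c)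
    ≡⟨ cong₂ (λ n S → + n - S) (FiniteFieldProperties.length-codeword F (suc r) k a)
                               (CharacteristicTwo.sum-sign-codeword≡Kloosterman r F s a≢0) ⟩
  + ((2 ^ suc r ∸ 1) ^ k) - Kloosterman F (suc r) k a
    ∎
  where
  k = 2 ^ s ∸ 1
  c = codeword F (suc r) k a
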